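{- Let a graph $G$ be factored into graphs $H$ and $K$, and let $u,v$ be vertices with $\deg_H(u)=\deg_H(v)=1$ and $u$ adjacent to $v$ in $H$. For a vertex $s$ let $C_K(s)$ denote the vertex set of the connected component of $K$ containing $s$, and for $x\in C_K(u)\cup C_K(v)$ let $\varphi(x)$ be the unique neighbor of $x$ in $H$. Then $\varphi$ restricted to $C_K(u)$ is an isomorphism from the component of $K$ on $C_K(u)$ onto the component of $K$ on $C_K(v)$, and moreover $N_H(C_K(u))=C_K(v)$ and $N_H(C_K(v))=C_K(u)$.
   Context: All graphs are finite, simple and undirected, and $G$ has no isolated vertices. For graphs $H,K$ on the vertex set $V(G)$, $G$ is factored into $H$ and $K$ if $A=BC$, where $A,B,C$ are the adjacency matrices of $G,H,K$ with respect to one common ordering of the vertices. For a set $S$ of vertices, $N_H(S)$ is the set of all vertices adjacent in $H$ to some vertex of $S$. (Each vertex of $C_K(u)\cup C_K(v)$ has exactly one neighbor in $H$, so $\varphi$ is well defined.) -}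

module Defs where

open import Data.Nat using (ℕ; zero; suc; _+_; _*_)
open import Data.Fin using (Fin; zero; suc)
open import Data.Bool using (Bool; true; false; if_then_else_)
open import Data.Product using (Σ; ∃; _×_; _,_)
open import Data.Sum using (_⊎_)
open import Relation.Binary.PropositionalEquality using (_≡_)

record Graph (n : ℕ) : Set where
  field
    adj    : Fin n → Fin n → Bool
    sym    : ∀ i j → adj i j ≡ adj j i
    irrefl : ∀ i → adj i i ≡ false
open Graph public

_∼[_]_ : ∀ {n} → Fin n → Graph n → Fin n → Set
i ∼[ G ] j = adj G i j ≡ true

AdjMat : ∀ {n} → Graph n → Fin n → Fin n → ℕ
AdjMat G i j = if adj G i j then 1 else 0

∑ : ∀ {n} → (Fin n → ℕ) → ℕ
∑ {zero}  f = 0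
∑ {suc n} f = f zero + ∑ (λ k → f (suc k))

FactoredInto : ∀ {n} → Graph n → Graph n → Graph n → Set
FactoredInto G H K =
  ∀ i j → AdjMat G i j ≡ ∑ (λ k → AdjMat H i k * AdjMat K k j)

NoIsolated : ∀ {n} → Graph n → Set
NoIsolated G = ∀ i → ∃ λ j → i ∼[ G ] j

deg : ∀ {n} → Graph n → Fin n → ℕ
deg G u = ∑ (λ k → AdjMat G u k)

data Reach {n} (K : Graph n) (s : Fin n) : Fin n → Set where
  here : Reach K s s
  step : ∀ {x y} → Reach K s x → x ∼[ K ] y → Reach K s y

C[_] : ∀ {n} → Graph n → Fin n → Fin n → Set
C[ K ] s x = Reach K s x

InNbhd : ∀ {n} → Graph n → (Fin n → Set) → Fin n → Set
InNbhd H S y = ∃ λ x → S x × (x ∼[ H ] y)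

IsIsoOn : ∀ {n} → Graph n → (Fin n → Set) → (Fin n → Set) → (Fin n → Fin n) → Set
IsIsoOn K S T φ =
    (∀ x → S x → T (φ x))
  × (∀ x y → S x → S y → φ x ≡ φ y → x ≡ y)
  × (∀ y → T y → ∃ λ x → S x × φ x ≡ y)
  × (∀ x y → S x → S y → adj K x y ≡ adj K (φ x) (φ y))

-- A vertex x with deg_H x = 1 and its H-neighbour x' behave like a matched pair: if
-- x ∼K y and y ∼H y', then y' ∼H y ∼K x gives y' ∼G x, and factoring that G-edge from
-- x's side must pass through x', so x' ∼K y'. In particular every H-neighbour of y is a
-- K-neighbour of x', whence deg_H y = (BC)_{y x'} = A_{y x'} = 1. So degree one spreads
-- over K-components, and H-edges carry K-edges of C_K(u) to K-edges of C_K(v) and back.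
module Submission where

open import Defs
open import Data.Nat using (ℕ; zero; suc; _+_; _*_; _≤_; _<_; s≤s; z≤n)
open import Data.Nat.Properties using (≤-trans; ≤-reflexive; m≤m+n; m≤n+m; +-monoʳ-≤; +-comm; *-identityˡ)
open import Data.Fin using (Fin; zero; suc; _≟_)
open import Data.Bool using (true; false)
open import Data.Bool.Properties using (⇔→≡)
open import Data.Product using (∃; _×_; _,_)
open import Data.Sum using (_⊎_; inj₁; inj₂)
open import Data.Empty using (⊥-elim)
open import Relation.Nullary using (yes; no; ¬_)
open import Function.Bundles using (_⇔_; mk⇔)
open import Relation.Binary.PropositionalEquality
  using (_≡_; refl; cong; cong₂; subst; trans; module ≡-Reasoning) renaming (sym to ≡-sym)

∑-cong : ∀ {n} {f g : Fin n → ℕ} → (∀ k → f k ≡ g k) → ∑ f ≡ ∑ g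
∑-cong {zero}  f≡g = refl
∑-cong {suc n} f≡g = cong₂ _+_ (f≡g zero) (∑-cong (λ k → f≡g (suc k)))

term≤∑ : ∀ {n} (f : Fin n → ℕ) k → f k ≤ ∑ f
term≤∑ f zero    = m≤m+n _ _
term≤∑ f (suc k) = ≤-trans (term≤∑ (λ i → f (suc i)) k) (m≤n+m _ _)

term+term≤∑ : ∀ {n} (f : Fin n → ℕ) a b → ¬ a ≡ b → f a + f b ≤ ∑ f
term+term≤∑ f zero    zero    a≢b = ⊥-elim (a≢b refl)
term+term≤∑ f zero    (suc b) a≢b = +-monoʳ-≤ (f zero) (term≤∑ _ b)
term+term≤∑ f (suc a) zero    a≢b =
  ≤-trans (≤-reflexive (+-comm (f (suc a)) (f zero))) (+-monoʳ-≤ (f zero) (term≤∑ _ a))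
term+term≤∑ f (suc a) (suc b) a≢b =
  ≤-trans (term+term≤∑ (λ i → f (suc i)) a b (λ a≡b → a≢b (cong suc a≡b))) (m≤n+m _ _)

∑-pos⇒∃-pos : ∀ {n} (f : Fin n → ℕ) → 0 < ∑ f → ∃ λ k → 0 < f k
∑-pos⇒∃-pos {zero}  f ()
∑-pos⇒∃-pos {suc n} f ∑f>0 with f zero in f0≡
... | suc _ = zero , subst (0 <_) (≡-sym f0≡) (s≤s z≤n)
... | zero  with ∑-pos⇒∃-pos (λ i → f (suc i)) ∑f>0
...   | k , fk>0 = suc k , fk>0

module _ {n} (G : Graph n) where

  ∼-sym : ∀ {i j} → i ∼[ G ] j → j ∼[ G ] i
  ∼-sym {i} {j} i∼j = trans (Graph.sym G j i) i∼j

  AdjMat-∼ : ∀ {i j} → i ∼[ G ] j → AdjMat G i j ≡ 1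
  AdjMat-∼ i∼j rewrite i∼j = refl

  AdjMat-pos⇒∼ : ∀ {i j} → 0 < AdjMat G i j → i ∼[ G ] j
  AdjMat-pos⇒∼ {i} {j} _   with adj G i j
  AdjMat-pos⇒∼         _   | true = refl
  AdjMat-pos⇒∼         ()  | false

  Leaf : Fin n → Set
  Leaf x = deg G x ≡ 1

  leaf⇒∃-neighbour : ∀ {x} → Leaf x → ∃ λ y → x ∼[ G ] y
  leaf⇒∃-neighbour {x} leaf with ∑-pos⇒∃-pos (AdjMat G x) (subst (0 <_) (≡-sym leaf) (s≤s z≤n))
  ... | y , pos = y , AdjMat-pos⇒∼ pos

  leaf-neighbour-unique : ∀ {x a b} → Leaf x → x ∼[ G ] a → x ∼[ G ] b → a ≡ b
  leaf-neighbour-unique {x} {a} {b} leaf x∼a x∼b with a ≟ b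
  ... | yes a≡b = a≡b
  ... | no  a≢b with ≤-trans (subst (_≤ deg G x) (cong₂ _+_ (AdjMat-∼ x∼a) (AdjMat-∼ x∼b))
                                    (term+term≤∑ (AdjMat G x) a b a≢b))
                             (≤-reflexive leaf)
  ...   | s≤s ()

AdjMat*AdjMat-pos : ∀ {n} (H K : Graph n) {i k j} →
  0 < AdjMat H i k * AdjMat K k j → i ∼[ H ] k × k ∼[ K ] j
AdjMat*AdjMat-pos H K {i} {k} {j} _  with adj H i k | adj K k j
AdjMat*AdjMat-pos H K             _  | true  | true  = refl , refl
AdjMat*AdjMat-pos H K             () | true  | false
AdjMat*AdjMat-pos H K             () | false | _

module Factored {n} (G H K : Graph n) (factored : FactoredInto G H K) where

  ∼H∘∼K⇒∼G : ∀ {i k j} → i ∼[ H ] k → k ∼[ K ] j → i ∼[ G ] j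
  ∼H∘∼K⇒∼G {i} {k} {j} i∼k k∼j = AdjMat-pos⇒∼ G (subst (0 <_) (≡-sym (factored i j))
    (≤-trans (≤-reflexive (≡-sym (cong₂ _*_ (AdjMat-∼ H i∼k) (AdjMat-∼ K k∼j))))
             (term≤∑ (λ k' → AdjMat H i k' * AdjMat K k' j) k)))

  ∼G⇒∼H∘∼K : ∀ {i j} → i ∼[ G ] j → ∃ λ k → i ∼[ H ] k × k ∼[ K ] j
  ∼G⇒∼H∘∼K {i} {j} i∼j
    with ∑-pos⇒∃-pos (λ k → AdjMat H i k * AdjMat K k j)
                     (subst (0 <_) (trans (≡-sym (AdjMat-∼ G i∼j)) (factored i j)) (s≤s z≤n))
  ... | k , pos = k , AdjMat*AdjMat-pos H K pos

  K-edge-across-H : ∀ {x x' y y'} → Leaf H x → x ∼[ H ] x' → x ∼[ K ] y → y ∼[ H ] y' →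
                    x' ∼[ K ] y'
  K-edge-across-H leaf x∼x' x∼y y∼y'
    with ∼G⇒∼H∘∼K (∼-sym G (∼H∘∼K⇒∼G (∼-sym H y∼y') (∼-sym K x∼y)))
  ... | k , x∼k , k∼y' = subst (_∼[ K ] _) (≡-sym (leaf-neighbour-unique H leaf x∼x' x∼k)) k∼y'

  leaf-along-K : ∀ {x y} → Leaf H x → x ∼[ K ] y → Leaf H y
  leaf-along-K {x} {y} leaf x∼y with leaf⇒∃-neighbour H leaf
  ... | x' , x∼x' = begin
    ∑ (AdjMat H y)                            ≡⟨ ∑-cong H-row≡H*K-column ⟩
    ∑ (λ k → AdjMat H y k * AdjMat K k x')    ≡⟨ ≡-sym (factored y x') ⟩
    AdjMat G y x'                             ≡⟨ AdjMat-∼ G (∼-sym G (∼H∘∼K⇒∼G (∼-sym H x∼x') x∼y)) ⟩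
    1                                         ∎
    where
    open ≡-Reasoning
    H-row≡H*K-column : ∀ k → AdjMat H y k ≡ AdjMat H y k * AdjMat K k x'
    H-row≡H*K-column k with adj H y k in y∼k
    ... | false = refl
    ... | true  = ≡-sym (trans (*-identityˡ _) (AdjMat-∼ K (∼-sym K (K-edge-across-H leaf x∼x' x∼y y∼k))))

  leaf-on-component : ∀ {s x} → Leaf H s → C[ K ] s x → Leaf H x
  leaf-on-component leaf here       = leaf
  leaf-on-component leaf (step r e) = leaf-along-K (leaf-on-component leaf r) e

  component-across-H : ∀ {s t x y} → Leaf H s → s ∼[ H ] t → C[ K ] s x → x ∼[ H ] y → C[ K ] t y
  component-across-H {t = t} leaf s∼t here s∼y =
    subst (C[ K ] t) (leaf-neighbour-unique H leaf s∼t s∼y) here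
  component-across-H leaf s∼t (step {x₀} r x₀∼x) x∼y
    with leaf⇒∃-neighbour H (leaf-on-component leaf r)
  ... | z , x₀∼z = step (component-across-H leaf s∼t r x₀∼z)
                        (K-edge-across-H (leaf-on-component leaf r) x₀∼z x₀∼x x∼y)

  InNbhd-component⇔component : ∀ {s t} → Leaf H s → Leaf H t → s ∼[ H ] t →
                               ∀ y → InNbhd H (C[ K ] s) y ⇔ C[ K ] t y
  InNbhd-component⇔component leafs leaft s∼t y = mk⇔
    (λ { (x , r , x∼y) → component-across-H leafs s∼t r x∼y })
    (λ r → let (x , y∼x) = leaf⇒∃-neighbour H (leaf-on-component leaft r)
           in x , component-across-H leaft (∼-sym H s∼t) r y∼x , ∼-sym H y∼x)

  H-neighbour-isoOn : ∀ {s t} → Leaf H s → Leaf H t → s ∼[ H ] t → (φ : Fin n → Fin n) →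
                      (∀ x → C[ K ] s x ⊎ C[ K ] t x → x ∼[ H ] φ x) →
                      IsIsoOn K (C[ K ] s) (C[ K ] t) φ
  H-neighbour-isoOn {s} {t} leafs leaft s∼t φ x∼φx = maps , injective , surjective , preserves
    where
    φ∼ : ∀ {x} → C[ K ] s x → φ x ∼[ H ] x
    φ∼ r = ∼-sym H (x∼φx _ (inj₁ r))

    maps : ∀ x → C[ K ] s x → C[ K ] t (φ x)
    maps x r = component-across-H leafs s∼t r (x∼φx x (inj₁ r))

    injective : ∀ x y → C[ K ] s x → C[ K ] s y → φ x ≡ φ y → x ≡ y
    injective x y rx ry φx≡φy = leaf-neighbour-unique H (leaf-on-component leaft (maps x rx))
      (φ∼ rx) (subst (_∼[ H ] y) (≡-sym φx≡φy) (φ∼ ry))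

    surjective : ∀ y → C[ K ] t y → ∃ λ x → C[ K ] s x × φ x ≡ y
    surjective y r = φ y , rφy , leaf-neighbour-unique H (leaf-on-component leafs rφy)
                                   (x∼φx (φ y) (inj₁ rφy)) (∼-sym H (x∼φx y (inj₂ r)))
      where
      rφy = component-across-H leaft (∼-sym H s∼t) r (x∼φx y (inj₂ r))

    preserves : ∀ x y → C[ K ] s x → C[ K ] s y → adj K x y ≡ adj K (φ x) (φ y)
    preserves x y rx ry = ⇔→≡ (mk⇔
      (λ x∼y → K-edge-across-H (leaf-on-component leafs rx) (x∼φx x (inj₁ rx)) x∼y (x∼φx y (inj₁ ry)))
      (λ φx∼φy → K-edge-across-H (leaf-on-component leaft (maps x rx)) (φ∼ rx) φx∼φy (φ∼ ry)))

mainTheorem7 : ∀ {n} (G H K : Graph n) → NoIsolated G → FactoredInto G H K →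
    (u v : Fin n) → deg H u ≡ 1 → deg H v ≡ 1 → u ∼[ H ] v →
    ((∀ x → C[ K ] u x ⊎ C[ K ] v x → deg H x ≡ 1)
    × (∀ (φ : Fin n → Fin n) → (∀ x → C[ K ] u x ⊎ C[ K ] v x → x ∼[ H ] φ x) →
    IsIsoOn K (C[ K ] u) (C[ K ] v) φ)
    × (∀ y → InNbhd H (C[ K ] u) y ⇔ C[ K ] v y)
    × (∀ y → InNbhd H (C[ K ] v) y ⇔ C[ K ] u y))
mainTheorem7 G H K _ factored u v leafu leafv u∼v =
    leaf-on-union
  , H-neighbour-isoOn leafu leafv u∼v
  , InNbhd-component⇔component leafu leafv u∼v
  , InNbhd-component⇔component leafv leafu (∼-sym H u∼v)
  where
  open Factored G H K factored
  leaf-on-union : ∀ x → C[ K ] u x ⊎ C[ K ] v x → Leaf H x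
  leaf-on-union x (inj₁ r) = leaf-on-component leafu r
  leaf-on-union x (inj₂ r) = leaf-on-component leafv r
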